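{- The graph $R_g = \{(\sigma, \tau) \in \mathbb{N}_\infty^{\mathbb{N}} \times \mathbb{N}_\infty^{\mathbb{N}} : g(\sigma) = g(\tau)\}$ of the equivalence relation $\sim_g$ is closed in the product space $\mathbb{N}_\infty^{\mathbb{N}} \times \mathbb{N}_\infty^{\mathbb{N}}$.
   Context: $\mathbb{N}_\infty = \mathbb{N} \cup \{\infty\}$ is the one-point compactification of the discrete space of positive integers, and $\mathbb{N}_\infty^{\mathbb{N}}$ has the product topology. The map $g \colon \mathbb{N}_\infty^{\mathbb{N}} \to \mathbb{N}_\infty^{\mathbb{N}}$ is given by $g(\sigma) = \sigma$ if $\sigma \in \mathbb{N}^{\mathbb{N}}$, and otherwise $g(\sigma) = (\sigma_1, \dots, \sigma_n, \infty, \infty, \dots)$ with $n \ge 0$ the least index such that $\sigma_{n+1} = \infty$; $\sigma \sim_g \tau$ iff $g(\sigma) = g(\tau)$. -}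

module Defs where

open import Data.Nat using (ℕ; zero; suc; _≤_; _<_)
open import Data.Product using (Σ; _×_)
open import Data.Sum using (_⊎_)
open import Relation.Binary.PropositionalEquality using (_≡_)

-- ℕ∞ = ℕ ∪ {∞}, the one-point compactification of a discrete countable set.
data ℕ∞ : Set where
  fin : ℕ → ℕ∞
  ∞   : ℕ∞

-- Points of ℕ∞^ℕ (coordinates indexed from 0).
Seq : Set
Seq = ℕ → ℕ∞

-- The map g : ℕ∞^ℕ → ℕ∞^ℕ, coordinatewise: g(σ)_k = σ_k if no ∞ occurs
-- among σ_0 … σ_(k-1), and ∞ otherwise.  (So g σ = σ if σ ∈ ℕ^ℕ, and
-- otherwise g σ = (σ_1,…,σ_n,∞,∞,…) with n least such that σ_(n+1) = ∞.)
g : Seq → Seq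
g σ zero = σ zero
g σ (suc k) with g σ k
... | fin _ = σ (suc k)
... | ∞     = ∞

Rg : Seq → Seq → Set
Rg σ τ = ∀ k → g σ k ≡ g τ k

-- Neighbourhood base of the one-point compactification ℕ∞:
-- for a finite point, {fin a} (isolated); for ∞, U_m = {∞} ∪ {fin b : m ≤ b}.
InNbhd : ℕ → ℕ∞ → ℕ∞ → Set
InNbhd m (fin a) y = y ≡ fin a
InNbhd m ∞       y = (y ≡ ∞) ⊎ Σ ℕ (λ b → (y ≡ fin b) × (m ≤ b))

-- Basic open neighbourhoods of σ in the product topology on ℕ∞^ℕ:
-- constrain the first n coordinates, each to its m-th base neighbourhood.
-- (These form a neighbourhood base at σ of the product topology.)
InBasic : ℕ → ℕ → Seq → Seq → Set
InBasic n m σ σ' = ∀ j → j < n → InNbhd m (σ j) (σ' j)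

InClosure : (Seq → Seq → Set) → Seq → Seq → Set
InClosure R σ τ =
  ∀ n m → Σ Seq (λ σ' → Σ Seq (λ τ' →
     InBasic n m σ σ' × InBasic n m τ τ' × R σ' τ'))

IsClosed : (Seq → Seq → Set) → Set
IsClosed R = ∀ σ τ → InClosure R σ τ → R σ τ

{-# OPTIONS --safe #-}
module Submission where

-- If g σ k is finite then σ 0 … σ k are finite, hence isolated in ℕ∞, so
-- every σ' close enough to σ agrees with σ on them and g σ' k = g σ k.
-- Argue by induction on k, using that ℕ∞ is Hausdorff.  If g σ k = g τ k = ∞
-- then both next coordinates are ∞.  If g σ k = g τ k = fin c then, near σ
-- and near τ, coordinate k+1 of g is coordinate k+1 of the point itself;
-- points of R_g arbitrarily near (σ, τ) share it, so σ (k+1) = τ (k+1).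

open import Defs
open import Data.Nat using (zero; suc; _≤_; _<_; s≤s; z≤n)
open import Data.Nat.Properties using (≤-refl; n<1+n; m≤n⇒m≤1+n; m≤n⇒m<n∨m≡n; ≤-<-trans; 1+n≰n)
open import Data.Product using (∃; _×_; _,_)
open import Data.Sum using (inj₁; inj₂)
open import Data.Empty using (⊥-elim)
open import Relation.Binary.PropositionalEquality using (_≡_; refl; sym; subst)
open Relation.Binary.PropositionalEquality.≡-Reasoning

ℕ∞-separated : ∀ x y → (∀ m → ∃ λ z → InNbhd m x z × InNbhd m y z) → x ≡ y
ℕ∞-separated (fin a) (fin b) common with common 0
... | _ , refl , refl = refl
ℕ∞-separated (fin a) ∞ common with common (suc a)
... | _ , refl , inj₁ ()
... | _ , refl , inj₂ (_ , refl , a<a) = ⊥-elim (1+n≰n a<a)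
ℕ∞-separated ∞ (fin b) common with common (suc b)
... | _ , inj₁ () , refl
... | _ , inj₂ (_ , refl , b<b) , refl = ⊥-elim (1+n≰n b<b)
ℕ∞-separated ∞ ∞ _ = refl

g-suc-fin : ∀ σ k {a} → g σ k ≡ fin a → g σ (suc k) ≡ σ (suc k)
g-suc-fin σ k gσk≡fin with g σ k
g-suc-fin σ k refl | fin _ = refl

g-fin⇒prefix-fin : ∀ σ k {a} → g σ k ≡ fin a → ∀ j → j ≤ k → ∃ λ b → σ j ≡ fin b
g-fin⇒prefix-fin σ zero gσ0≡fin zero z≤n = _ , gσ0≡fin
g-fin⇒prefix-fin σ (suc k) gσk+1≡fin j j≤k+1 with g σ k in gσk≡ | m≤n⇒m<n∨m≡n j≤k+1
... | fin _ | inj₁ (s≤s j≤k) = g-fin⇒prefix-fin σ k gσk≡ j j≤k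
... | fin _ | inj₂ refl      = _ , gσk+1≡fin

g-prefix-cong : ∀ σ σ' k → (∀ j → j ≤ k → σ j ≡ σ' j) → g σ k ≡ g σ' k
g-prefix-cong σ σ' zero agree = agree zero z≤n
g-prefix-cong σ σ' (suc k) agree
  with g σ k | g σ' k | g-prefix-cong σ σ' k (λ j j≤k → agree j (m≤n⇒m≤1+n j≤k))
... | fin _ | fin _ | refl = agree (suc k) ≤-refl
... | ∞     | ∞     | refl = refl

InBasic-fixes-finite-prefix : ∀ {n m σ σ'} k {a} → k < n → g σ k ≡ fin a →
                              InBasic n m σ σ' → ∀ j → j ≤ k → σ j ≡ σ' j
InBasic-fixes-finite-prefix {m = m} {σ} {σ'} k k<n gσk≡fin near j j≤k
  with g-fin⇒prefix-fin σ k gσk≡fin j j≤k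
... | _ , σj≡fin = begin
  σ j   ≡⟨ σj≡fin ⟩
  fin _ ≡⟨ sym (subst (λ x → InNbhd m x (σ' j)) σj≡fin (near j (≤-<-trans j≤k k<n))) ⟩
  σ' j  ∎

g-locally-constant : ∀ {n m σ σ'} k {a} → k < n → g σ k ≡ fin a →
                     InBasic n m σ σ' → g σ' k ≡ fin a
g-locally-constant {σ = σ} {σ'} k k<n gσk≡fin near = begin
  g σ' k ≡⟨ sym (g-prefix-cong σ σ' k (InBasic-fixes-finite-prefix k k<n gσk≡fin near)) ⟩
  g σ  k ≡⟨ gσk≡fin ⟩
  fin _  ∎

closure-coord-≡ : ∀ {R σ τ} n j → j < n → InClosure R σ τ →
                  (∀ {m σ' τ'} → InBasic n m σ σ' → InBasic n m τ τ' → R σ' τ' → σ' j ≡ τ' j) →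
                  σ j ≡ τ j
closure-coord-≡ {σ = σ} {τ} n j j<n cl coord-≡ = ℕ∞-separated (σ j) (τ j) λ m →
  let (σ' , τ' , σ'-near , τ'-near , related) = cl n m in
  σ' j , σ'-near j j<n , subst (InNbhd m (τ j)) (sym (coord-≡ σ'-near τ'-near related)) (τ'-near j j<n)

lemma3p7 : IsClosed Rg
lemma3p7 σ τ cl zero = closure-coord-≡ 1 0 (n<1+n 0) cl (λ _ _ related → related 0)
lemma3p7 σ τ cl (suc k) with g σ k in gσk≡ | g τ k in gτk≡ | lemma3p7 σ τ cl k
... | ∞     | ∞      | refl = refl
... | fin c | fin .c | refl = closure-coord-≡ (suc (suc k)) (suc k) (n<1+n (suc k)) cl coord-≡
  where
  k<k+2 : k < suc (suc k)
  k<k+2 = m≤n⇒m≤1+n (n<1+n k)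

  coord-≡ : ∀ {m σ' τ'} → InBasic (suc (suc k)) m σ σ' → InBasic (suc (suc k)) m τ τ' →
            Rg σ' τ' → σ' (suc k) ≡ τ' (suc k)
  coord-≡ {σ' = σ'} {τ'} σ'-near τ'-near related = begin
    σ' (suc k)   ≡⟨ sym (g-suc-fin σ' k (g-locally-constant k k<k+2 gσk≡ σ'-near)) ⟩
    g σ' (suc k) ≡⟨ related (suc k) ⟩
    g τ' (suc k) ≡⟨ g-suc-fin τ' k (g-locally-constant k k<k+2 gτk≡ τ'-near) ⟩
    τ' (suc k)   ∎
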